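{- Let $\mathcal P$ be a link-preserving property of simplicial complexes and let $d\ge0$. If there are only finitely many (up to isomorphism) strong obstructions to $\mathcal P$ of dimension at most $d$, then there are only finitely many (up to isomorphism) obstructions to $\mathcal P$ of dimension at most $d$.
   Context: A simplicial complex is a family of subsets of a finite set closed under taking subsets, with vertex set $V(\Gamma)$; for $W\subseteq V(\Gamma)$, $\Gamma[W]$ is the subcomplex of faces contained in $W$; $\mathrm{link}_\Gamma(\tau)=\{\eta\in\Gamma:\eta\cap\tau=\emptyset,\eta\cup\tau\in\Gamma\}$. A property $\mathcal P$ is link-preserving if whenever $\Gamma$ satisfies $\mathcal P$, $\mathrm{link}_\Gamma(\tau)$ satisfies $\mathcal P$ for all $\tau\in\Gamma$. $\Gamma$ is an obstruction to $\mathcal P$ if it does not satisfy $\mathcal P$ but $\Gamma[W]$ satisfies $\mathcal P$ for all $W\subsetneq V(\Gamma)$. $\Gamma$ is a strong obstruction to $\mathcal P$ if it does not satisfy $\mathcal P$ but $\mathrm{link}_{\Gamma[W]}(\tau)$ satisfies $\mathcal P$ for every $W\subseteq V(\Gamma)$ and $\tau\in\Gamma[W]$ except $W=V(\Gamma)$, $\tau=\emptyset$. -}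

module Defs where

open import Data.Nat using (ℕ; zero; suc; _≤_)
open import Data.Bool using (Bool; true; false; T; _∧_; if_then_else_)
open import Data.Bool.Properties using (T-∧)
open import Data.Fin using (Fin; zero; suc)
open import Data.Fin.Subset using (Subset; _∈_; _∉_; _⊆_; _∪_; _∩_; ⁅_⁆; ⊥; ∣_∣; Nonempty; Empty)
open import Data.Fin.Subset.Properties using (_⊆?_; nonempty?; x∈p∪q⁺; x∈p∪q⁻; x∈p∩q⁺; x∈p∩q⁻; ⊆-trans)
open import Data.Vec using ([]; _∷_)
open import Data.List using (List)
open import Data.List.Relation.Unary.Any using (Any)
open import Data.Product using (Σ; ∃; _×_; _,_; proj₁; proj₂)
open import Data.Sum using (_⊎_; inj₁; inj₂; [_,_])
open import Relation.Nullary using (¬_; ¬?)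
open import Relation.Nullary.Decidable using (⌊_⌋; toWitness; fromWitness)
open import Relation.Binary.PropositionalEquality using (_≡_)
open import Function using (_∘_; _⇔_; Equivalence)

-- Ground elements which are
-- not vertices are allowed; the vertex set V(Γ) is {v | {v} ∈ Γ}.
record Complex : Set where
  field
    n      : ℕ
    face   : Subset n → Bool
    closed : ∀ {σ τ : Subset n} → σ ⊆ τ → T (face τ) → T (face σ)
open Complex public

IsFace : (Γ : Complex) → Subset (n Γ) → Set
IsFace Γ σ = T (face Γ σ)

_∈V_ : ∀ {Γ : Complex} → Fin (n Γ) → Set
_∈V_ {Γ} v = IsFace Γ ⁅ v ⁆

Vert : (Γ : Complex) → Fin (n Γ) → Set
Vert Γ v = IsFace Γ ⁅ v ⁆

_⊆V_ : ∀ {Γ : Complex} → Subset (n Γ) → Set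
_⊆V_ {Γ} W = ∀ {v} → v ∈ W → Vert Γ v

-- W ≠ V(Γ) (given W ⊆ V(Γ)): some vertex of Γ lies outside W
Missing : (Γ : Complex) → Subset (n Γ) → Set
Missing Γ W = ∃ λ v → Vert Γ v × v ∉ W

induced : (Γ : Complex) → Subset (n Γ) → Complex
induced Γ W = record
  { n = n Γ
  ; face = λ σ → face Γ σ ∧ ⌊ σ ⊆? W ⌋
  ; closed = λ {σ} {τ} σ⊆τ h →
      let (fτ , sτ) = Equivalence.to (T-∧ {face Γ τ}) h
      in Equivalence.from (T-∧ {face Γ σ})
           ( closed Γ σ⊆τ fτ
           , fromWitness {a? = σ ⊆? W} (λ {x} → ⊆-trans {i = σ} {j = τ} {k = W} σ⊆τ (toWitness {a? = τ ⊆? W} sτ) {x}) )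
  }

-- link_Γ(τ) = {η ∈ Γ | η ∩ τ = ∅, η ∪ τ ∈ Γ}
-- (the condition η ∈ Γ is implied by η ∪ τ ∈ Γ and closure)
link : (Γ : Complex) → Subset (n Γ) → Complex
link Γ τ = record
  { n = n Γ
  ; face = λ η → ⌊ ¬? (nonempty? (η ∩ τ)) ⌋ ∧ face Γ (η ∪ τ)
  ; closed = λ {η'} {η} η'⊆η h →
      let (dj , fu) = Equivalence.to (T-∧ {⌊ ¬? (nonempty? (η ∩ τ)) ⌋}) h
          emp = toWitness {a? = ¬? (nonempty? (η ∩ τ))} dj
      in Equivalence.from (T-∧ {⌊ ¬? (nonempty? (η' ∩ τ)) ⌋})
           ( fromWitness (λ { (x , x∈) →
                 let (a , b) = x∈p∩q⁻ η' τ x∈ in emp (x , x∈p∩q⁺ (η'⊆η a , b)) })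
           , closed Γ (λ {x} x∈ → [ (λ a → x∈p∪q⁺ (inj₁ (η'⊆η a))) , (λ b → x∈p∪q⁺ (inj₂ b)) ]
                                   (x∈p∪q⁻ η' τ x∈)) fu )
  }

image : ∀ {k m} → (Fin k → Fin m) → Subset k → Subset m
image {zero}  f []      = ⊥
image {suc k} f (b ∷ σ) = (if b then ⁅ f zero ⁆ else ⊥) ∪ image (f ∘ suc) σ

record _≅_ (Γ Δ : Complex) : Set where
  field
    f      : Fin (n Γ) → Fin (n Δ)
    g      : Fin (n Δ) → Fin (n Γ)
    f-vert : ∀ v → Vert Γ v → Vert Δ (f v)
    g-vert : ∀ w → Vert Δ w → Vert Γ (g w)
    gf     : ∀ v → Vert Γ v → g (f v) ≡ v
    fg     : ∀ w → Vert Δ w → f (g w) ≡ w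
    f-face : ∀ σ → IsFace Γ σ → IsFace Δ (image f σ)
    g-face : ∀ τ → IsFace Δ τ → IsFace Γ (image g τ)

Property : Set₁
Property = Complex → Set

IsoInvariant : Property → Set
IsoInvariant P = ∀ Γ Δ → Γ ≅ Δ → P Γ → P Δ

LinkPreserving : Property → Set
LinkPreserving P = ∀ Γ → P Γ → ∀ τ → IsFace Γ τ → P (link Γ τ)

DimAtMost : ℕ → Complex → Set
DimAtMost d Γ = ∀ σ → IsFace Γ σ → ∣ σ ∣ ≤ suc d

Obstruction : Property → Complex → Set
Obstruction P Γ =
  ¬ P Γ ×
  (∀ (W : Subset (n Γ)) → _⊆V_ {Γ} W → Missing Γ W → P (induced Γ W))

StrongObstruction : Property → Complex → Set
StrongObstruction P Γ =
  ¬ P Γ ×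
  (∀ (W : Subset (n Γ)) → _⊆V_ {Γ} W →
     ∀ (τ : Subset (n Γ)) → IsFace (induced Γ W) τ →
     (Missing Γ W ⊎ Nonempty τ) →           -- (W , τ) ≠ (V(Γ) , ∅)
     P (link (induced Γ W) τ))

FinitelyManyUpToIso : (Complex → Set) → Set
FinitelyManyUpToIso Q = ∃ λ (L : List Complex) → ∀ Γ → Q Γ → Any (Γ ≅_) L

module Submission where

-- Among the pairs (W , τ) with W ⊆ V(Γ), τ ∈ Γ[W] and link_{Γ[W]}(τ) failing P, one minimising
-- |W| + |V ∖ τ| makes Δ = link_{Γ[W]}(τ) a strong obstruction: a link of an induced subcomplex of Δ
-- is again such a link of Γ, of smaller weight. If Γ is an obstruction, every vertex v of Γ lies in τ
-- or in V(Δ), for otherwise Δ is also the link of τ in Γ[W - v], which has P because Γ[W - v] does.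
-- So |V(Γ)| ≤ d + 1 + |V(Δ)|, which is bounded through the finitely many strong obstructions, and
-- there are only finitely many complexes with boundedly many vertices up to isomorphism. As P need
-- not be decidable, the minimal pair only exists under a double negation; this suffices because the
-- vertex bound is a decidable statement.

open import Defs
open import Data.Nat using (ℕ; zero; suc; _+_; _≤_; _<_; _≤?_; z≤n; s≤s)
open import Data.Nat.Properties
  using (≤-trans; ≤-reflexive; m≤m+n; m≤n+m; +-mono-≤; +-mono-<-≤; +-mono-≤-<; +-suc; n≤1+n; <-≤-trans; module ≤-Reasoning)
open import Data.Nat.Induction using (<-wellFounded)
open import Data.Nat.ListAction using (sum)
open import Data.Bool using (Bool; true; false; T; if_then_else_)
open import Data.Bool.Properties using (T-∧; T-≡; T?)
open import Data.Fin using (Fin; zero; suc; punchIn; punchOut; _≟_)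
open import Data.Fin.Properties
  using (all?; ¬∀⟶∃¬; suc-injective; punchIn-punchOut; punchOut-punchIn; punchOut-cong; punchInᵢ≢i)
open import Data.Fin.Subset
  using (Subset; _∈_; _∉_; _⊆_; _∪_; _∩_; ∁; ⁅_⁆; ⊥; ⊤; ∣_∣; Nonempty; _-_)
open import Data.Fin.Subset.Properties
open import Data.Vec using ([]; _∷_; tabulate; here; there)
open import Data.Vec.Properties using (lookup∘tabulate; lookup⇒[]=; []=⇒lookup)
open import Data.List using (List; []; _∷_; map; concatMap; upTo; cartesianProductWith)
open import Data.List.Relation.Unary.Any as Any using (Any; here; there)
open import Data.List.Relation.Unary.Any.Properties using (map⁺; concatMap⁺; cartesianProductWith⁺)
open import Data.List.Membership.Propositional using (lose)
open import Data.List.Membership.Propositional.Properties using (∈-upTo⁺)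
open import Data.Product using (∃; ∃₂; _×_; _,_; proj₁; proj₂)
open import Data.Sum using (_⊎_; inj₁; inj₂; [_,_]′)
open import Induction.WellFounded using (Acc; acc)
open import Relation.Nullary using (¬_; yes; no; ¬?)
open import Relation.Nullary.Decidable using (⌊_⌋; toWitness; fromWitness; decidable-stable; _×-dec_)
open import Relation.Nullary.Negation using (¬¬-map; contradiction)
open import Relation.Binary.PropositionalEquality using (_≡_; _≗_; refl; sym; trans; cong; subst)
open import Function using (_∘_; id; const; Equivalence)

image⁺ : ∀ {k m} (f : Fin k → Fin m) {σ : Subset k} {x} → x ∈ σ → f x ∈ image f σ
image⁺ f {true ∷ σ}  here        = x∈p∪q⁺ (inj₁ (x∈⁅x⁆ (f zero)))
image⁺ f {true ∷ σ}  (there x∈σ) = x∈p∪q⁺ (inj₂ (image⁺ (f ∘ suc) x∈σ))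
image⁺ f {false ∷ σ} (there x∈σ) = x∈p∪q⁺ {p = ⊥} (inj₂ (image⁺ (f ∘ suc) x∈σ))

image⁻ : ∀ {k m} (f : Fin k → Fin m) (σ : Subset k) {y} → y ∈ image f σ → ∃ λ x → x ∈ σ × f x ≡ y
image⁻ f []          y∈ = contradiction y∈ ∉⊥
image⁻ f (true ∷ σ)  y∈ with x∈p∪q⁻ ⁅ f zero ⁆ (image (f ∘ suc) σ) y∈
... | inj₁ y∈⁅f0⁆ = zero , here , sym (x∈⁅y⁆⇒x≡y _ y∈⁅f0⁆)
... | inj₂ y∈rest = let x , x∈σ , eq = image⁻ (f ∘ suc) σ y∈rest in suc x , there x∈σ , eq
image⁻ f (false ∷ σ) y∈ with x∈p∪q⁻ ⊥ (image (f ∘ suc) σ) y∈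
... | inj₁ y∈⊥    = contradiction y∈⊥ ∉⊥
... | inj₂ y∈rest = let x , x∈σ , eq = image⁻ (f ∘ suc) σ y∈rest in suc x , there x∈σ , eq

image-⊆ : ∀ {k m} (f : Fin k → Fin m) {σ : Subset k} {τ : Subset m} →
          (∀ {x} → x ∈ σ → f x ∈ τ) → image f σ ⊆ τ
image-⊆ f {σ} f[σ]⊆τ y∈ with image⁻ f σ y∈
... | x , x∈σ , refl = f[σ]⊆τ x∈σ

image-mono : ∀ {k m} (f : Fin k → Fin m) {σ τ : Subset k} → σ ⊆ τ → image f σ ⊆ image f τ
image-mono f σ⊆τ = image-⊆ f (image⁺ f ∘ σ⊆τ)

Disjoint : ∀ {m} → Subset m → Subset m → Set
Disjoint p q = ∀ {x} → x ∈ p → x ∉ q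

∪-lub : ∀ {m} {p q r : Subset m} → p ⊆ r → q ⊆ r → p ∪ q ⊆ r
∪-lub {p = p} {q} p⊆r q⊆r x∈ = [ p⊆r , q⊆r ]′ (x∈p∪q⁻ p q x∈)

∪-disjoint : ∀ {m} {p q r : Subset m} → Disjoint p r → Disjoint q r → Disjoint (p ∪ q) r
∪-disjoint {p = p} {q} p#r q#r x∈ = [ p#r , q#r ]′ (x∈p∪q⁻ p q x∈)

x∈p⇒⁅x⁆⊆p : ∀ {m} {x : Fin m} {p : Subset m} → x ∈ p → ⁅ x ⁆ ⊆ p
x∈p⇒⁅x⁆⊆p {p = p} x∈p y∈⁅x⁆ = subst (_∈ p) (sym (x∈⁅y⁆⇒x≡y _ y∈⁅x⁆)) x∈p

x∉p⇒p⊆∁⁅x⁆ : ∀ {m} {x : Fin m} {p : Subset m} → x ∉ p → p ⊆ ∁ ⁅ x ⁆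
x∉p⇒p⊆∁⁅x⁆ {p = p} x∉p y∈p = x∉p⇒x∈∁p (λ y∈⁅x⁆ → x∉p (subst (_∈ p) (x∈⁅y⁆⇒x≡y _ y∈⁅x⁆) y∈p))

∣p∪q∣≤∣p∣+∣q∣ : ∀ {m} (p q : Subset m) → ∣ p ∪ q ∣ ≤ ∣ p ∣ + ∣ q ∣
∣p∪q∣≤∣p∣+∣q∣ []          []          = z≤n
∣p∪q∣≤∣p∣+∣q∣ (true ∷ p)  (true ∷ q)  = s≤s (≤-trans (∣p∪q∣≤∣p∣+∣q∣ p q) (≤-trans (n≤1+n _) (≤-reflexive (sym (+-suc ∣ p ∣ ∣ q ∣)))))
∣p∪q∣≤∣p∣+∣q∣ (true ∷ p)  (false ∷ q) = s≤s (∣p∪q∣≤∣p∣+∣q∣ p q)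
∣p∪q∣≤∣p∣+∣q∣ (false ∷ p) (true ∷ q)  = ≤-trans (s≤s (∣p∪q∣≤∣p∣+∣q∣ p q)) (≤-reflexive (sym (+-suc ∣ p ∣ ∣ q ∣)))
∣p∪q∣≤∣p∣+∣q∣ (false ∷ p) (false ∷ q) = ∣p∪q∣≤∣p∣+∣q∣ p q

injectiveOn⇒∣p∣≤∣q∣ : ∀ {a b} (f : Fin a → Fin b) {p : Subset a} {q : Subset b} →
  (∀ {x} → x ∈ p → f x ∈ q) → (∀ {x y} → x ∈ p → y ∈ p → f x ≡ f y → x ≡ y) → ∣ p ∣ ≤ ∣ q ∣
injectiveOn⇒∣p∣≤∣q∣ f {[]}        maps inj = z≤n
injectiveOn⇒∣p∣≤∣q∣ f {false ∷ p} maps inj =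
  injectiveOn⇒∣p∣≤∣q∣ (f ∘ suc) (maps ∘ there) (λ x∈ y∈ → suc-injective ∘ inj (there x∈) (there y∈))
injectiveOn⇒∣p∣≤∣q∣ f {true ∷ p} {q} maps inj = <-≤-trans ∣p∣<∣q-f0∣+1 (x∈p⇒∣p-x∣<∣p∣ (maps here))
  where
  ∣p∣<∣q-f0∣+1 : suc ∣ p ∣ ≤ suc ∣ q - f zero ∣
  ∣p∣<∣q-f0∣+1 = s≤s (injectiveOn⇒∣p∣≤∣q∣ (f ∘ suc)
    (λ x∈ → x∈p∧x≢y⇒x∈p-y (maps (there x∈)) (λ eq → contradiction (inj here (there x∈) (sym eq)) λ ()))
    (λ x∈ y∈ → suc-injective ∘ inj (there x∈) (there y∈)))

≤-any⇒≤sum : ∀ {m} {ns : List ℕ} → Any (m ≤_) ns → m ≤ sum ns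
≤-any⇒≤sum                (here m≤n)    = ≤-trans m≤n (m≤m+n _ _)
≤-any⇒≤sum {ns = n₀ ∷ ns} (there m≤sum) = ≤-trans (≤-any⇒≤sum m≤sum) (m≤n+m _ n₀)

DownClosed : ∀ {m} → (Subset m → Bool) → Set
DownClosed face = ∀ {σ τ} → σ ⊆ τ → T (face τ) → T (face σ)

face⇒vertex : ∀ Γ {σ v} → IsFace Γ σ → v ∈ σ → Vert Γ v
face⇒vertex Γ σ∈Γ v∈σ = closed Γ (x∈p⇒⁅x⁆⊆p v∈σ) σ∈Γ

vertices : (Γ : Complex) → Subset (n Γ)
vertices Γ = tabulate (λ v → face Γ ⁅ v ⁆)

∈-vertices⁺ : ∀ Γ {v} → Vert Γ v → v ∈ vertices Γ
∈-vertices⁺ Γ {v} v∈V =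
  lookup⇒[]= v (vertices Γ) (trans (lookup∘tabulate _ v) (Equivalence.to T-≡ v∈V))

∈-vertices⁻ : ∀ Γ {v} → v ∈ vertices Γ → Vert Γ v
∈-vertices⁻ Γ {v} v∈V =
  Equivalence.from T-≡ (trans (sym (lookup∘tabulate _ v)) ([]=⇒lookup v∈V))

≅-byFaces : ∀ {m} {face₁ face₂ : Subset m → Bool} {closed₁ : DownClosed face₁} {closed₂ : DownClosed face₂} →
  (∀ σ → T (face₁ σ) → T (face₂ σ)) → (∀ σ → T (face₂ σ) → T (face₁ σ)) →
  record { n = m ; face = face₁ ; closed = closed₁ } ≅ record { n = m ; face = face₂ ; closed = closed₂ }
≅-byFaces {closed₁ = closed₁} {closed₂} to from = record
  { f = id ; g = id
  ; f-vert = λ v → to ⁅ v ⁆ ; g-vert = λ w → from ⁅ w ⁆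
  ; gf = λ _ _ → refl ; fg = λ _ _ → refl
  ; f-face = λ σ σ∈ → closed₂ (image-⊆ id id) (to σ σ∈)
  ; g-face = λ τ τ∈ → closed₁ (image-⊆ id id) (from τ τ∈)
  }

≅-refl : ∀ {Γ} → Γ ≅ Γ
≅-refl = ≅-byFaces (λ _ → id) (λ _ → id)

≅-sym : ∀ {Γ Δ} → Γ ≅ Δ → Δ ≅ Γ
≅-sym i = record
  { f = g ; g = f ; f-vert = g-vert ; g-vert = f-vert ; gf = fg ; fg = gf ; f-face = g-face ; g-face = f-face }
  where open _≅_ i

≅-trans : ∀ {Γ Δ E} → Γ ≅ Δ → Δ ≅ E → Γ ≅ E
≅-trans {Γ} {Δ} {E} i j = record
  { f = J.f ∘ I.f ; g = I.g ∘ J.g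
  ; f-vert = λ v v∈V → J.f-vert _ (I.f-vert v v∈V)
  ; g-vert = λ w w∈V → I.g-vert _ (J.g-vert w w∈V)
  ; gf = λ v v∈V → trans (cong I.g (J.gf _ (I.f-vert v v∈V))) (I.gf v v∈V)
  ; fg = λ w w∈V → trans (cong J.f (I.fg _ (J.g-vert w w∈V))) (J.fg w w∈V)
  ; f-face = λ σ σ∈ → closed E (image-⊆ (J.f ∘ I.f) (image⁺ J.f ∘ image⁺ I.f)) (J.f-face _ (I.f-face σ σ∈))
  ; g-face = λ τ τ∈ → closed Γ (image-⊆ (I.g ∘ J.g) (image⁺ I.g ∘ image⁺ J.g)) (I.g-face _ (J.g-face τ τ∈))
  }
  where module I = _≅_ i
        module J = _≅_ j

≅⇒∣vertices∣≤ : ∀ {Γ Δ} → Γ ≅ Δ → ∣ vertices Γ ∣ ≤ ∣ vertices Δ ∣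
≅⇒∣vertices∣≤ {Γ} {Δ} i = injectiveOn⇒∣p∣≤∣q∣ f
  (λ v∈ → ∈-vertices⁺ Δ (f-vert _ (∈-vertices⁻ Γ v∈)))
  (λ {v} {w} v∈ w∈ fv≡fw → trans (sym (gf v (∈-vertices⁻ Γ v∈))) (trans (cong g fv≡fw) (gf w (∈-vertices⁻ Γ w∈))))
  where open _≅_ i

induced-face⁻ : ∀ Γ {W σ} → IsFace (induced Γ W) σ → IsFace Γ σ × σ ⊆ W
induced-face⁻ Γ {W} {σ} σ∈ =
  let σ∈Γ , σ⊆W = Equivalence.to (T-∧ {face Γ σ}) σ∈ in σ∈Γ , toWitness {a? = σ ⊆? W} σ⊆W

induced-face⁺ : ∀ Γ {W σ} → IsFace Γ σ → σ ⊆ W → IsFace (induced Γ W) σ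
induced-face⁺ Γ {W} {σ} σ∈Γ σ⊆W = Equivalence.from (T-∧ {face Γ σ}) (σ∈Γ , fromWitness {a? = σ ⊆? W} σ⊆W)

link-face⁻ : ∀ Γ {τ η} → IsFace (link Γ τ) η → Disjoint η τ × IsFace Γ (η ∪ τ)
link-face⁻ Γ {τ} {η} η∈ =
  let η#τ , η∪τ∈Γ = Equivalence.to (T-∧ {⌊ ¬? (nonempty? (η ∩ τ)) ⌋}) η∈
  in (λ x∈η x∈τ → toWitness η#τ (_ , x∈p∩q⁺ (x∈η , x∈τ))) , η∪τ∈Γ

link-face⁺ : ∀ Γ {τ η} → Disjoint η τ → IsFace Γ (η ∪ τ) → IsFace (link Γ τ) η
link-face⁺ Γ {τ} {η} η#τ η∪τ∈Γ = Equivalence.from (T-∧ {⌊ ¬? (nonempty? (η ∩ τ)) ⌋})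
  (fromWitness (λ (_ , x∈η∩τ) → let x∈η , x∈τ = x∈p∩q⁻ η τ x∈η∩τ in η#τ x∈η x∈τ) , η∪τ∈Γ)

inducedLink : (Γ : Complex) → Subset (n Γ) → Subset (n Γ) → Complex
inducedLink Γ W τ = link (induced Γ W) τ

inducedLink-face⁻ : ∀ Γ {W τ η} → IsFace (inducedLink Γ W τ) η →
  Disjoint η τ × IsFace Γ (η ∪ τ) × η ∪ τ ⊆ W
inducedLink-face⁻ Γ η∈ =
  let η#τ , η∪τ∈ = link-face⁻ (induced Γ _) η∈ in η#τ , induced-face⁻ Γ η∪τ∈

inducedLink-face⁺ : ∀ Γ {W τ η} → Disjoint η τ → IsFace Γ (η ∪ τ) → η ∪ τ ⊆ W →
  IsFace (inducedLink Γ W τ) η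
inducedLink-face⁺ Γ η#τ η∪τ∈Γ η∪τ⊆W = link-face⁺ (induced Γ _) η#τ (induced-face⁺ Γ η∪τ∈Γ η∪τ⊆W)

dim-inducedLink : ∀ {d Γ W τ} → DimAtMost d Γ → DimAtMost d (inducedLink Γ W τ)
dim-inducedLink {Γ = Γ} {τ = τ} dim η η∈ =
  ≤-trans (∣p∣≤∣p∪q∣ η τ) (dim _ (proj₁ (proj₂ (inducedLink-face⁻ Γ η∈))))

≅-inducedLink-vertices-⊥ : ∀ Γ → Γ ≅ inducedLink Γ (vertices Γ) ⊥
≅-inducedLink-vertices-⊥ Γ = ≅-byFaces
  (λ η η∈Γ → inducedLink-face⁺ Γ (λ _ → ∉⊥) (η∪⊥∈ η∈Γ)
               (λ x∈ → ∈-vertices⁺ Γ (face⇒vertex Γ (η∪⊥∈ η∈Γ) x∈)))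
  (λ η η∈ → subst (IsFace Γ) (∪-identityʳ η) (proj₁ (proj₂ (inducedLink-face⁻ Γ η∈))))
  where
  η∪⊥∈ : ∀ {η} → IsFace Γ η → IsFace Γ (η ∪ ⊥)
  η∪⊥∈ {η} = subst (IsFace Γ) (sym (∪-identityʳ η))

≅-inducedLink-delete : ∀ Γ {W τ v} → v ∉ τ → ¬ Vert (inducedLink Γ W τ) v →
  inducedLink Γ (W ∩ ∁ ⁅ v ⁆) τ ≅ inducedLink Γ W τ
≅-inducedLink-delete Γ {W} {τ} {v} v∉τ v∉Δ = ≅-byFaces
  (λ η η∈ → let η#τ , η∪τ∈Γ , η∪τ⊆ = inducedLink-face⁻ Γ η∈
            in inducedLink-face⁺ Γ η#τ η∪τ∈Γ (p∩q⊆p W _ ∘ η∪τ⊆))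
  (λ η η∈ → let η#τ , η∪τ∈Γ , η∪τ⊆W = inducedLink-face⁻ Γ η∈
                v∉η∪τ = [ (λ v∈η → v∉Δ (face⇒vertex (inducedLink Γ W τ) η∈ v∈η)) , v∉τ ]′ ∘ x∈p∪q⁻ η τ
            in inducedLink-face⁺ Γ η#τ η∪τ∈Γ (λ x∈ → x∈p∩q⁺ (η∪τ⊆W x∈ , x∉p⇒p⊆∁⁅x⁆ v∉η∪τ x∈)))

-- Links of induced subcomplexes of links

weight : ∀ {m} → Subset m → Subset m → ℕ
weight W τ = ∣ W ∣ + ∣ ∁ τ ∣

module Sublink (Γ : Complex) {W τ U σ : Subset (n Γ)}
               (τ∈ : IsFace (induced Γ W) τ) (σ∈ : IsFace (induced (inducedLink Γ W τ) U) σ) where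

  private
    τ⊆W : τ ⊆ W
    τ⊆W = proj₂ (induced-face⁻ Γ τ∈)
    σ∈Δ = proj₁ (induced-face⁻ (inducedLink Γ W τ) σ∈)
    σ⊆U : σ ⊆ U
    σ⊆U = proj₂ (induced-face⁻ (inducedLink Γ W τ) σ∈)
    σ#τ = proj₁ (inducedLink-face⁻ Γ σ∈Δ)
    σ∪τ∈Γ = proj₁ (proj₂ (inducedLink-face⁻ Γ σ∈Δ))
    σ∪τ⊆W = proj₂ (proj₂ (inducedLink-face⁻ Γ σ∈Δ))

  W′ τ′ : Subset (n Γ)
  W′ = (W ∩ U) ∪ τ
  τ′ = σ ∪ τ

  W′⊆W : W′ ⊆ W
  W′⊆W = ∪-lub (p∩q⊆p W U) τ⊆W

  τ′∈ : IsFace (induced Γ W′) τ′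
  τ′∈ = induced-face⁺ Γ σ∪τ∈Γ
    (∪-lub (λ x∈σ → p⊆p∪q τ (x∈p∩q⁺ (σ∪τ⊆W (p⊆p∪q τ x∈σ) , σ⊆U x∈σ))) (q⊆p∪q (W ∩ U) τ))

  -- Both sides consist of the η disjoint from σ ∪ τ with η ∪ σ ∪ τ ∈ Γ, η ∪ σ ⊆ U and η ∪ σ ∪ τ ⊆ W.
  ≅-sublink : link (induced (inducedLink Γ W τ) U) σ ≅ inducedLink Γ W′ τ′
  ≅-sublink = ≅-byFaces
    (λ η η∈ →
      let η#σ , η∪σ∈ = link-face⁻ (induced (inducedLink Γ W τ) U) η∈
          η∪σ∈Δ , η∪σ⊆U = induced-face⁻ (inducedLink Γ W τ) η∪σ∈
          η∪σ#τ , η∪σ∪τ∈Γ , η∪σ∪τ⊆W = inducedLink-face⁻ Γ η∪σ∈Δ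
          assoc = ∪-assoc η σ τ
      in inducedLink-face⁺ Γ
           (λ x∈η → [ η#σ x∈η , η∪σ#τ (p⊆p∪q σ x∈η) ]′ ∘ x∈p∪q⁻ σ τ)
           (subst (IsFace Γ) assoc η∪σ∪τ∈Γ)
           (subst (_⊆ W′) assoc
              (∪-lub (λ x∈ → p⊆p∪q τ (x∈p∩q⁺ (η∪σ∪τ⊆W (p⊆p∪q τ x∈) , η∪σ⊆U x∈))) (q⊆p∪q (W ∩ U) τ))))
    (λ η η∈ →
      let η#τ′ , η∪τ′∈Γ , η∪τ′⊆W′ = inducedLink-face⁻ Γ η∈
          assoc = sym (∪-assoc η σ τ)
          η⊆U : η ⊆ U
          η⊆U x∈η = [ proj₂ ∘ x∈p∩q⁻ W U , (λ x∈τ → contradiction (q⊆p∪q σ τ x∈τ) (η#τ′ x∈η)) ]′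
                      (x∈p∪q⁻ (W ∩ U) τ (η∪τ′⊆W′ (p⊆p∪q τ′ x∈η)))
      in link-face⁺ (induced (inducedLink Γ W τ) U)
           (λ x∈η → η#τ′ x∈η ∘ p⊆p∪q τ)
           (induced-face⁺ (inducedLink Γ W τ)
              (inducedLink-face⁺ Γ (∪-disjoint (λ x∈η → η#τ′ x∈η ∘ q⊆p∪q σ τ) σ#τ)
                 (subst (IsFace Γ) assoc η∪τ′∈Γ)
                 (subst (_⊆ W) assoc (W′⊆W ∘ η∪τ′⊆W′)))
              (∪-lub η⊆U σ⊆U)))

  weight-decreasing : Missing (inducedLink Γ W τ) U ⊎ Nonempty σ → weight W′ τ′ < weight W τ
  weight-decreasing (inj₁ (v , v∈Δ , v∉U)) =
    +-mono-<-≤ (p⊂q⇒∣p∣<∣q∣ (W′⊆W , v , v∈W , v∉W′)) (p⊆q⇒∣p∣≤∣q∣ (p⊆q⇒∁p⊇∁q (q⊆p∪q σ τ)))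
    where
    v#τ = proj₁ (inducedLink-face⁻ Γ v∈Δ) (x∈⁅x⁆ v)
    v∈W = proj₂ (proj₂ (inducedLink-face⁻ Γ v∈Δ)) (p⊆p∪q τ (x∈⁅x⁆ v))
    v∉W′ : v ∉ W′
    v∉W′ = [ v∉U ∘ proj₂ ∘ x∈p∩q⁻ W U , v#τ ]′ ∘ x∈p∪q⁻ (W ∩ U) τ
  weight-decreasing (inj₂ (x , x∈σ)) =
    +-mono-≤-< (p⊆q⇒∣p∣≤∣q∣ W′⊆W) (p⊂q⇒∣p∣<∣q∣ (p⊂q⇒∁p⊃∁q (q⊆p∪q σ τ , x , p⊆p∪q τ x∈σ , σ#τ x∈σ)))

¬¬-∀-Subset : ∀ {m} {B : Subset m → Set} → (∀ σ → ¬ ¬ B σ) → ¬ ¬ (∀ σ → B σ)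
¬¬-∀-Subset {zero}      ¬¬B ¬∀B = ¬¬B [] (λ b → ¬∀B λ { [] → b })
¬¬-∀-Subset {suc m} {B} ¬¬B ¬∀B =
  ¬¬-∀-Subset {B = B ∘ (true ∷_)} (¬¬B ∘ (true ∷_)) λ ∀inside →
  ¬¬-∀-Subset {B = B ∘ (false ∷_)} (¬¬B ∘ (false ∷_)) λ ∀outside →
  ¬∀B λ { (true ∷ σ) → ∀inside σ ; (false ∷ σ) → ∀outside σ }

¬¬-→ : ∀ {A B : Set} → (A → ¬ ¬ B) → ¬ ¬ (A → B)
¬¬-→ ¬¬B ¬A→B = ¬A→B (λ a → contradiction (λ b → ¬A→B (const b)) (¬¬B a))

¬¬-strongObstruction : ∀ {P : Property} {Δ} → ¬ P Δ →
  (∀ U → _⊆V_ {Δ} U → ∀ σ → IsFace (induced Δ U) σ → Missing Δ U ⊎ Nonempty σ → ¬ ¬ P (link (induced Δ U) σ)) →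
  ¬ ¬ StrongObstruction P Δ
¬¬-strongObstruction {Δ = Δ} ¬PΔ ¬¬P = ¬¬-map (¬PΔ ,_)
  (¬¬-∀-Subset λ U → ¬¬-→ {A = _⊆V_ {Δ} U} λ U⊆V → ¬¬-∀-Subset λ σ → ¬¬-→ λ σ∈ → ¬¬-→ (¬¬P U U⊆V σ σ∈))

-- Minimal links failing P

HasStrongObstructionLink : Property → Complex → Set
HasStrongObstructionLink P Γ =
  ∃₂ λ W τ → _⊆V_ {Γ} W × IsFace (induced Γ W) τ × StrongObstruction P (inducedLink Γ W τ)

strongObstruction-below : ∀ {P} → IsoInvariant P → ∀ Γ {W τ} → _⊆V_ {Γ} W → IsFace (induced Γ W) τ →
  ¬ P (inducedLink Γ W τ) →
  ¬ ¬ (HasStrongObstructionLink P Γ)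
strongObstruction-below {P} P-iso Γ {W} {τ} = go (<-wellFounded (weight W τ))
  where
  go : ∀ {W τ} → Acc _<_ (weight W τ) → _⊆V_ {Γ} W → IsFace (induced Γ W) τ → ¬ P (inducedLink Γ W τ) →
    ¬ ¬ (HasStrongObstructionLink P Γ)
  go {W} {τ} (acc lighter) W⊆V τ∈ ¬P none =
    ¬¬-strongObstruction {P} {inducedLink Γ W τ} ¬P sublinks (λ so → none (W , τ , W⊆V , τ∈ , so))
    where
    sublinks : ∀ U → _⊆V_ {inducedLink Γ W τ} U → ∀ σ → (σ∈ : IsFace (induced (inducedLink Γ W τ) U) σ) →
               Missing (inducedLink Γ W τ) U ⊎ Nonempty σ →
               ¬ ¬ P (link (induced (inducedLink Γ W τ) U) σ)
    sublinks U _ σ σ∈ proper ¬Pσ =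
      go (lighter (weight-decreasing proper)) (W⊆V ∘ W′⊆W) τ′∈ (¬Pσ ∘ P-iso _ _ (≅-sym ≅-sublink)) none
      where open Sublink Γ τ∈ σ∈

-- Vertex bound for obstructions

vertices⊆face∪linkVertices : ∀ {P} → IsoInvariant P → LinkPreserving P → ∀ {Γ} → Obstruction P Γ →
  ∀ {W τ} → _⊆V_ {Γ} W → IsFace (induced Γ W) τ → ¬ P (inducedLink Γ W τ) →
  vertices Γ ⊆ τ ∪ vertices (inducedLink Γ W τ)
vertices⊆face∪linkVertices P-iso P-link {Γ} (_ , P-proper) {W} {τ} W⊆V τ∈ ¬P {v} v∈V
  with v ∈? τ ∪ vertices (inducedLink Γ W τ)
... | yes v∈ = v∈
... | no v∉ = contradiction (P-iso _ _ (≅-inducedLink-delete Γ v∉τ v∉Δ) (P-link _ P-W-v τ τ∈W-v)) ¬P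
  where
  v∉τ = v∉ ∘ p⊆p∪q _
  v∉Δ = v∉ ∘ q⊆p∪q τ _ ∘ ∈-vertices⁺ (inducedLink Γ W τ)
  P-W-v = P-proper (W ∩ ∁ ⁅ v ⁆) (W⊆V ∘ p∩q⊆p W _)
            (v , ∈-vertices⁻ Γ v∈V , λ v∈ → x∈∁p⇒x∉p (proj₂ (x∈p∩q⁻ W _ v∈)) (x∈⁅x⁆ v))
  τ∈W-v = induced-face⁺ Γ (proj₁ (induced-face⁻ Γ τ∈))
            (λ x∈τ → x∈p∩q⁺ (proj₂ (induced-face⁻ Γ τ∈) x∈τ , x∉p⇒p⊆∁⁅x⁆ v∉τ x∈τ))

≅-any⇒∣vertices∣≤sum : ∀ {Δ} {L : List Complex} → Any (Δ ≅_) L → ∣ vertices Δ ∣ ≤ sum (map n L)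
≅-any⇒∣vertices∣≤sum Δ∈L =
  ≤-any⇒≤sum (map⁺ (Any.map (λ {E} Δ≅E → ≤-trans (≅⇒∣vertices∣≤ Δ≅E) (∣p∣≤n (vertices E))) Δ∈L))

obstruction-vertexBound : ∀ {P} → IsoInvariant P → LinkPreserving P → ∀ {d} (L : List Complex) →
  (∀ Δ → StrongObstruction P Δ × DimAtMost d Δ → Any (Δ ≅_) L) →
  ∀ {Γ} → Obstruction P Γ → DimAtMost d Γ → ∣ vertices Γ ∣ ≤ suc d + sum (map n L)
obstruction-vertexBound {P} P-iso P-link {d} L L-complete {Γ} obs dim with T? (face Γ ⊥)
... | no ⊥∉Γ = ≤-trans (subst (∣ vertices Γ ∣ ≤_) (∣⊥∣≡0 (n Γ)) (p⊆q⇒∣p∣≤∣q∣ noVertices)) z≤n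
  where
  noVertices : vertices Γ ⊆ ⊥
  noVertices v∈V = contradiction (closed Γ ⊥⊆ (∈-vertices⁻ Γ v∈V)) ⊥∉Γ
... | yes ⊥∈Γ = decidable-stable (∣ vertices Γ ∣ ≤? suc d + sum (map n L)) (¬¬-map bound
      (strongObstruction-below {P} P-iso Γ (∈-vertices⁻ Γ) (induced-face⁺ Γ ⊥∈Γ ⊥⊆)
         (proj₁ obs ∘ P-iso _ _ (≅-sym (≅-inducedLink-vertices-⊥ Γ)))))
  where
  open ≤-Reasoning
  bound : HasStrongObstructionLink P Γ → ∣ vertices Γ ∣ ≤ suc d + sum (map n L)
  bound (W , τ , W⊆V , τ∈ , so) = begin
    ∣ vertices Γ ∣                             ≤⟨ p⊆q⇒∣p∣≤∣q∣ (vertices⊆face∪linkVertices P-iso P-link obs W⊆V τ∈ (proj₁ so)) ⟩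
    ∣ τ ∪ vertices (inducedLink Γ W τ) ∣       ≤⟨ ∣p∪q∣≤∣p∣+∣q∣ τ _ ⟩
    ∣ τ ∣ + ∣ vertices (inducedLink Γ W τ) ∣   ≤⟨ +-mono-≤ (dim τ (proj₁ (induced-face⁻ Γ τ∈)))
                                                    (≅-any⇒∣vertices∣≤sum (L-complete _ (so , dim-inducedLink {Γ = Γ} dim))) ⟩
    suc d + sum (map n L)                      ∎

-- Complexes on a bounded ground set, up to isomorphism

byHead : ∀ {m} → (Subset m → Bool) → (Subset m → Bool) → Subset (suc m) → Bool
byHead t₁ t₀ (b ∷ σ) = if b then t₁ σ else t₀ σ

booleanFunctions : (m : ℕ) → List (Subset m → Bool)
booleanFunctions zero    = const true ∷ const false ∷ []
booleanFunctions (suc m) = cartesianProductWith byHead (booleanFunctions m) (booleanFunctions m)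

booleanFunctions-complete : ∀ m (h : Subset m → Bool) → Any (_≗ h) (booleanFunctions m)
booleanFunctions-complete zero h with h [] in h[]≡
... | true  = here λ { [] → sym h[]≡ }
... | false = there (here λ { [] → sym h[]≡ })
booleanFunctions-complete (suc m) h =
  cartesianProductWith⁺ byHead (λ t₁≗ t₀≗ → λ { (true ∷ σ) → t₁≗ σ ; (false ∷ σ) → t₀≗ σ })
    (booleanFunctions-complete m (h ∘ (true ∷_))) (booleanFunctions-complete m (h ∘ (false ∷_)))

generatedBy : (m : ℕ) → (Subset m → Bool) → Complex
generatedBy m t = record
  { n = m
  ; face = λ σ → ⌊ anySubset? (λ ρ → T? (t ρ) ×-dec σ ⊆? ρ) ⌋
  ; closed = λ σ⊆τ τ∈ → let ρ , tρ , τ⊆ρ = toWitness τ∈ in fromWitness (ρ , tρ , λ {x} x∈σ → τ⊆ρ (σ⊆τ x∈σ))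
  }

≅-generatedBy : ∀ Γ {t} → t ≗ face Γ → Γ ≅ generatedBy (n Γ) t
≅-generatedBy Γ {t} t≗face = ≅-byFaces
  (λ σ σ∈Γ → fromWitness (σ , subst T (sym (t≗face σ)) σ∈Γ , λ {x} x∈σ → x∈σ))
  (λ σ σ∈ → let ρ , tρ , σ⊆ρ = toWitness σ∈ in closed Γ σ⊆ρ (subst T (t≗face ρ) tρ))

complexesOn : ℕ → List Complex
complexesOn m = map (generatedBy m) (booleanFunctions m)

complexesOn-complete : ∀ Γ → Any (Γ ≅_) (complexesOn (n Γ))
complexesOn-complete Γ = map⁺ (Any.map (≅-generatedBy Γ) (booleanFunctions-complete (n Γ) (face Γ)))

complexesUpTo : ℕ → List Complex
complexesUpTo B = concatMap complexesOn (upTo (suc B))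

complexesUpTo-complete : ∀ {B} Γ → n Γ ≤ B → Any (Γ ≅_) (complexesUpTo B)
complexesUpTo-complete Γ n≤B = concatMap⁺ complexesOn (lose (∈-upTo⁺ (s≤s n≤B)) (complexesOn-complete Γ))

-- Discarding ground elements that are not vertices

pullback : ∀ Γ {a} → (Fin a → Fin (n Γ)) → Complex
pullback Γ {a} g = record { n = a ; face = face Γ ∘ image g ; closed = closed Γ ∘ image-mono g }

≅-pullback : ∀ Γ {a} (g : Fin a → Fin (n Γ)) (f : Fin (n Γ) → Fin a) →
  (∀ w → f (g w) ≡ w) → (∀ v → Vert Γ v → g (f v) ≡ v) → Γ ≅ pullback Γ g
≅-pullback Γ g f fg gf = record
  { f = f ; g = g
  ; f-vert = λ v v∈V → closed Γ (image-⊆ g λ {x} x∈ →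
      subst (_∈ ⁅ v ⁆) (sym (trans (cong g (x∈⁅y⁆⇒x≡y _ x∈)) (gf v v∈V))) (x∈⁅x⁆ v)) v∈V
  ; g-vert = λ w w∈V → closed Γ (x∈p⇒⁅x⁆⊆p (image⁺ g (x∈⁅x⁆ w))) w∈V
  ; gf = gf
  ; fg = λ w _ → fg w
  ; f-face = λ σ σ∈Γ → closed Γ (image-⊆ g (gf-⊆ σ∈Γ)) σ∈Γ
  ; g-face = λ _ → id
  }
  where
  gf-⊆ : ∀ {σ} → IsFace Γ σ → ∀ {y} → y ∈ image f σ → g y ∈ σ
  gf-⊆ {σ} σ∈Γ y∈ with image⁻ f σ y∈
  ... | x , x∈σ , refl = subst (_∈ σ) (sym (gf x (face⇒vertex Γ σ∈Γ x∈σ))) x∈σ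

all-vertices⇒n≤∣vertices∣ : ∀ Γ → (∀ v → Vert Γ v) → n Γ ≤ ∣ vertices Γ ∣
all-vertices⇒n≤∣vertices∣ Γ allVertices = ≤-trans (≤-reflexive (sym (∣⊤∣≡n (n Γ))))
  (p⊆q⇒∣p∣≤∣q∣ {p = ⊤} {q = vertices Γ} (λ {v} _ → ∈-vertices⁺ Γ (allVertices v)))

-- The + 1 is needed for a one-point ground set whose point is not a vertex: Fin 1 has no map to Fin 0.
shrink : ∀ m (face : Subset m → Bool) (closed : DownClosed face) →
  ∃ λ Γ′ → record { n = m ; face = face ; closed = closed } ≅ Γ′ × n Γ′ ≤ suc ∣ vertices Γ′ ∣
shrinkAt : ∀ m (face : Subset (suc m) → Bool) (closed : DownClosed face) → ∀ i → ¬ T (face ⁅ i ⁆) →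
  ∃ λ Γ′ → record { n = suc m ; face = face ; closed = closed } ≅ Γ′ × n Γ′ ≤ suc ∣ vertices Γ′ ∣

shrink zero face closed = _ , ≅-refl , z≤n
shrink (suc m) face closed with all? (λ v → T? (face ⁅ v ⁆))
... | yes allVertices = _ , ≅-refl , ≤-trans (all-vertices⇒n≤∣vertices∣ Γ allVertices) (n≤1+n _)
  where Γ = record { n = suc m ; face = face ; closed = closed }
... | no notAll = let i , i∉V = ¬∀⟶∃¬ (suc m) _ (λ v → T? (face ⁅ v ⁆)) notAll in shrinkAt m face closed i i∉V

shrinkAt zero    face closed i i∉V = _ , ≅-refl , s≤s z≤n
shrinkAt (suc k) face closed i i∉V =
  let Γ′ , Γᵢ≅Γ′ , bound = shrink (suc k) (face ∘ image (punchIn i)) (closed ∘ image-mono (punchIn i))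
  in Γ′ , ≅-trans (≅-pullback Γ (punchIn i) f fg gf) Γᵢ≅Γ′ , bound
  where
  Γ = record { n = suc (suc k) ; face = face ; closed = closed }
  f : Fin (suc (suc k)) → Fin (suc k)
  f v with i ≟ v
  ... | yes _   = zero
  ... | no  i≢v = punchOut i≢v
  fg : ∀ w → f (punchIn i w) ≡ w
  fg w with i ≟ punchIn i w
  ... | yes i≡ = contradiction (sym i≡) (punchInᵢ≢i i w)
  ... | no  i≢ = trans (punchOut-cong i refl) (punchOut-punchIn i)
  gf : ∀ v → Vert Γ v → punchIn i (f v) ≡ v
  gf v v∈V with i ≟ v
  ... | yes refl = contradiction v∈V i∉V
  ... | no  i≢v  = punchIn-punchOut i≢v

theorem4p6 : (P : Property) → IsoInvariant P → LinkPreserving P → (d : ℕ) →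
    FinitelyManyUpToIso (λ Γ → StrongObstruction P Γ × DimAtMost d Γ) →
    FinitelyManyUpToIso (λ Γ → Obstruction P Γ × DimAtMost d Γ)
theorem4p6 P P-iso P-link d (L , L-complete) = complexesUpTo (suc M) , λ Γ (obs , dim) →
  let Γ′ , Γ≅Γ′ , n≤ = shrink (n Γ) (face Γ) (closed Γ)
      open ≤-Reasoning
      n′≤ = begin
        n Γ′                  ≤⟨ n≤ ⟩
        suc ∣ vertices Γ′ ∣  ≤⟨ s≤s (≅⇒∣vertices∣≤ (≅-sym Γ≅Γ′)) ⟩
        suc ∣ vertices Γ ∣   ≤⟨ s≤s (obstruction-vertexBound P-iso P-link L L-complete obs dim) ⟩
        suc M                ∎
  in Any.map (≅-trans Γ≅Γ′) (complexesUpTo-complete Γ′ n′≤)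
  where
  M = suc d + sum (map n L)
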